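{- Let $n$ be a positive integer, let $x\ge 2$ be an integer and $b=2^x-1$, and suppose the base-$b$ representation $2^n=(c_k,c_{k-1},\ldots,c_0)_b$ is palindromic. Then: (1) $n>k(x-1)$. (2) Suppose $r=n-kx\ge 0$. If $k\le x-r$, or if $3\le k\le x-r+1$ and $x\ge 3$, then the palindromic representation of $2^n$ in base $b$ is the binomial form \[2^r\left(\binom{k}{k},\binom{k}{k-1},\ldots,\binom{k}{0}\right)_b,\] i.e. $c_i=2^r\binom{k}{i}$ for all $i=0,\ldots,k$.
   Context: For an integer $b>1$, every positive integer $N$ can be written uniquely as $N=\sum_{i=0}^k c_i b^i$ with integers $0\le c_i<b$ and $c_k>0$; this is written $N=(c_k,\ldots,c_0)_b$. It is palindromic if $c_j=c_{k-j}$ for all $j=0,\ldots,k$. -}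

module Defs where

open import Data.Nat using (ℕ; zero; suc; _+_; _*_; _^_; _<_)
open import Data.Fin using (Fin; toℕ; opposite)
open import Data.Fin.Properties using ()
open import Data.Product using (_×_)
open import Relation.Binary.PropositionalEquality using (_≡_)

-- value of the digit string (c_k, …, c_0) in base b : Σ_{i=0}^{k} c_i b^i
-- (digits indexed by Fin (suc k), index i ↦ coefficient of b^i)
value : (b k : ℕ) → (Fin (suc k) → ℕ) → ℕ
value b k c = go (suc k) (λ i → c i) 
  where
  go : (m : ℕ) → (Fin m → ℕ) → ℕ
  go zero    d = 0
  go (suc m) d = d Data.Fin.zero + b * go m (λ i → d (Data.Fin.suc i))

IsBaseRep : (b N k : ℕ) → (Fin (suc k) → ℕ) → Set
IsBaseRep b N k c =
  ((i : Fin (suc k)) → c i < b) ×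
  (0 < c (Data.Fin.fromℕ k)) ×
  (value b k c ≡ N)

IsPalindromic : (k : ℕ) → (Fin (suc k) → ℕ) → Set
IsPalindromic k c = (j : Fin (suc k)) → c j ≡ c (opposite j)

-- Adding the binomial digits 2^r·C(k,i) in base b = 2^x − 1 gives 2^r (b + 1)^k = 2^(r + kx).
-- Under either smallness condition on k and r every such digit is below b, so by uniqueness
-- of base-b digits this is the representation of 2^n. The bound k(x − 1) < n comes from
-- comparing 2^n ≥ b^k with b > 2^(x−1).
module Submission where

open import Defs
open import Data.Nat using (ℕ; suc; _+_; _*_; _∸_; _^_; _≤_; _<_)
open import Data.Nat.Combinatorics using (_C_)
open import Data.Fin using (Fin; toℕ)
open import Data.Product using (_×_)
open import Data.Sum using (_⊎_)
open import Relation.Binary.PropositionalEquality using (_≡_)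

open import Data.Nat using (zero; z≤n; s≤s; s≤s⁻¹; NonZero; _%_; +-*-rawSemiring)
open import Data.Nat.DivMod using (m<n⇒m%n≡m; [m+kn]%n≡m%n)
open import Data.Nat.Properties
open import Data.Nat.Combinatorics using (nCk+nC[k+1]≡[n+1]C[k+1])
open import Data.Nat.Tactic.RingSolver using (solve-∀)
open import Data.Fin using (fromℕ) renaming (zero to fz; suc to fs)
open import Data.Product using (_,_; proj₁; proj₂)
open import Data.Sum using (inj₁; inj₂)
open import Function using (_∘_)
open import Relation.Binary.PropositionalEquality using (refl; sym; trans; cong; cong₂; subst; module ≡-Reasoning)
open import Algebra.Properties.Semiring.Sum +-*-semiring using (*-distribˡ-sum; sum-cong-≗)
open import Algebra.Properties.Monoid.Sum +-0-monoid using (sum⁺-syntax)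
open import Algebra.Properties.CommutativeSemigroup *-commutativeSemigroup using (x∙yz≈y∙xz)
import Algebra.Definitions.RawSemiring +-*-rawSemiring as ℕ-Semiring
import Algebra.Properties.CommutativeSemiring.Binomial +-*-commutativeSemiring as Binomial

×≡* : ∀ m n → m ℕ-Semiring.× n ≡ m * n
×≡* zero    n = refl
×≡* (suc m) n = cong (n +_) (×≡* m n)

^≡^ : ∀ m n → m ℕ-Semiring.^ n ≡ m ^ n
^≡^ m zero    = refl
^≡^ m (suc n) = cong (m *_) (^≡^ m n)

2^[1+n]≡2^n+2^n : ∀ n → 2 ^ suc n ≡ 2 ^ n + 2 ^ n
2^[1+n]≡2^n+2^n n = cong (2 ^ n +_) (+-identityʳ (2 ^ n))

suc[2^n∸1]≡2^n : ∀ n → suc (2 ^ n ∸ 1) ≡ 2 ^ n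
suc[2^n∸1]≡2^n n = m+[n∸m]≡n (m^n>0 2 n)

2+m≤n⇒m<n∸1 : ∀ {m n} → 2 + m ≤ n → m < n ∸ 1
2+m≤n⇒m<n∸1 = ∸-monoˡ-≤ 1

^-cancelʳ-< : ∀ m .{{_ : NonZero m}} {i j} → m ^ i < m ^ j → i < j
^-cancelʳ-< m mⁱ<mʲ = ≰⇒> (λ j≤i → <⇒≱ mⁱ<mʲ (^-monoʳ-≤ m j≤i))

2^[x∸1]<2^x∸1 : ∀ {x} → 2 ≤ x → 2 ^ (x ∸ 1) < 2 ^ x ∸ 1
2^[x∸1]<2^x∸1 {suc x} (s≤s 1≤x) = 2+m≤n⇒m<n∸1 (begin
  2 + 2 ^ x      ≤⟨ +-monoˡ-≤ (2 ^ x) (^-monoʳ-≤ 2 1≤x) ⟩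
  2 ^ x + 2 ^ x  ≡⟨ 2^[1+n]≡2^n+2^n x ⟨
  2 ^ suc x      ∎)
  where open ≤-Reasoning

[1+n]Ck≤2^n : ∀ n k → suc n C k ≤ 2 ^ n
[1+n]Ck≤2^n zero    zero          = ≤-refl
[1+n]Ck≤2^n zero    (suc zero)    = ≤-refl
[1+n]Ck≤2^n zero    (suc (suc k)) = z≤n
[1+n]Ck≤2^n (suc n) zero          = m^n>0 2 (suc n)
[1+n]Ck≤2^n (suc n) (suc k)       = begin
  suc (suc n) C suc k          ≡⟨ nCk+nC[k+1]≡[n+1]C[k+1] (suc n) k ⟨
  suc n C k + suc n C suc k    ≤⟨ +-mono-≤ ([1+n]Ck≤2^n n k) ([1+n]Ck≤2^n n (suc k)) ⟩
  2 ^ n + 2 ^ n                ≡⟨ 2^[1+n]≡2^n+2^n n ⟨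
  2 ^ suc n                    ∎
  where open ≤-Reasoning

3Ck≤3 : ∀ k → 3 C k ≤ 3
3Ck≤3 0 = s≤s z≤n
3Ck≤3 1 = ≤-refl
3Ck≤3 2 = ≤-refl
3Ck≤3 3 = s≤s z≤n
3Ck≤3 (suc (suc (suc (suc k)))) = z≤n

2+[4+n]Ck≤2^[3+n] : ∀ n k → 2 + (4 + n) C k ≤ 2 ^ (3 + n)
2+[4+n]Ck≤2^[3+n] zero 0 = ≤ᵇ⇒≤ 3 8 _
2+[4+n]Ck≤2^[3+n] zero 1 = ≤ᵇ⇒≤ 6 8 _
2+[4+n]Ck≤2^[3+n] zero 2 = ≤ᵇ⇒≤ 8 8 _
2+[4+n]Ck≤2^[3+n] zero 3 = ≤ᵇ⇒≤ 6 8 _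
2+[4+n]Ck≤2^[3+n] zero 4 = ≤ᵇ⇒≤ 3 8 _
2+[4+n]Ck≤2^[3+n] zero (suc (suc (suc (suc (suc k))))) = ≤ᵇ⇒≤ 2 8 _
2+[4+n]Ck≤2^[3+n] (suc n) zero = ≤-trans (n≤1+n 3) (^-monoʳ-≤ 2 {2} {4 + n} (s≤s (s≤s z≤n)))
2+[4+n]Ck≤2^[3+n] (suc n) (suc k) = begin
  2 + (5 + n) C suc k                           ≡⟨ cong (2 +_) (nCk+nC[k+1]≡[n+1]C[k+1] (4 + n) k) ⟨
  2 + ((4 + n) C k + (4 + n) C suc k)           ≤⟨ m≤m+n _ 2 ⟩
  2 + ((4 + n) C k + (4 + n) C suc k) + 2       ≡⟨ regroup ((4 + n) C k) ((4 + n) C suc k) ⟩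
  (2 + (4 + n) C k) + (2 + (4 + n) C suc k)     ≤⟨ +-mono-≤ (2+[4+n]Ck≤2^[3+n] n k) (2+[4+n]Ck≤2^[3+n] n (suc k)) ⟩
  2 ^ (3 + n) + 2 ^ (3 + n)                     ≡⟨ 2^[1+n]≡2^n+2^n (3 + n) ⟨
  2 ^ (4 + n)                                   ∎
  where
  open ≤-Reasoning
  regroup : ∀ a b → 2 + (a + b) + 2 ≡ (2 + a) + (2 + b)
  regroup = solve-∀

value-∑ : ∀ b k (c : Fin (suc k) → ℕ) → value b k c ≡ ∑[ i ≤ k ] (c i * b ^ toℕ i)
value-∑ b zero    c = cong₂ _+_ (sym (*-identityʳ (c fz))) (*-zeroʳ b)
value-∑ b (suc k) c = begin
    c fz + b * value b k (c ∘ fs)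
  ≡⟨ cong (λ v → c fz + b * v) (value-∑ b k (c ∘ fs)) ⟩
    c fz + b * ∑[ i ≤ k ] (c (fs i) * b ^ toℕ i)
  ≡⟨ cong₂ _+_ (sym (*-identityʳ (c fz))) (*-distribˡ-sum b (λ i → c (fs i) * b ^ toℕ i)) ⟩
    c fz * 1 + ∑[ i ≤ k ] (b * (c (fs i) * b ^ toℕ i))
  ≡⟨ cong (c fz * 1 +_) (sum-cong-≗ (λ i → x∙yz≈y∙xz b (c (fs i)) (b ^ toℕ i))) ⟩
    c fz * 1 + ∑[ i ≤ k ] (c (fs i) * (b * b ^ toℕ i))
  ∎
  where open ≡-Reasoning

value-zero : ∀ b (c : Fin 1 → ℕ) → value b 0 c ≡ c fz
value-zero b c = trans (cong (c fz +_) (*-zeroʳ b)) (+-identityʳ (c fz))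

value-* : ∀ b k a (c : Fin (suc k) → ℕ) → value b k (λ i → a * c i) ≡ a * value b k c
value-* b zero    a c = distrib a (c fz) b
  where
  distrib : ∀ a x b → a * x + b * 0 ≡ a * (x + b * 0)
  distrib = solve-∀
value-* b (suc k) a c =
  trans (cong (λ v → a * c fz + b * v) (value-* b k a (c ∘ fs))) (distrib a (c fz) b (value b k (c ∘ fs)))
  where
  distrib : ∀ a x b v → a * x + b * (a * v) ≡ a * (x + b * v)
  distrib = solve-∀

value-binomial : ∀ b k → value b k (λ i → k C toℕ i) ≡ suc b ^ k
value-binomial b k = begin
    value b k (λ i → k C toℕ i)
  ≡⟨ value-∑ b k (λ i → k C toℕ i) ⟩
    ∑[ i ≤ k ] ((k C toℕ i) * b ^ toℕ i)
  ≡⟨ sum-cong-≗ term ⟨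
    Binomial.binomialExpansion b 1 k
  ≡⟨ Binomial.theorem k b 1 ⟨
    (b + 1) ℕ-Semiring.^ k
  ≡⟨ trans (^≡^ (b + 1) k) (cong (_^ k) (+-comm b 1)) ⟩
    suc b ^ k
  ∎
  where
  open ≡-Reasoning
  term : ∀ i → Binomial.binomialTerm b 1 k i ≡ (k C toℕ i) * b ^ toℕ i
  term i = begin
      Binomial.binomialTerm b 1 k i
    ≡⟨ ×≡* (k C toℕ i) _ ⟩
      (k C toℕ i) * (b ℕ-Semiring.^ toℕ i * 1 ℕ-Semiring.^ (k ∸ toℕ i))
    ≡⟨ cong ((k C toℕ i) *_) (cong₂ _*_ (^≡^ b (toℕ i)) (trans (^≡^ 1 (k ∸ toℕ i)) (^-zeroˡ (k ∸ toℕ i)))) ⟩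
      (k C toℕ i) * (b ^ toℕ i * 1)
    ≡⟨ cong ((k C toℕ i) *_) (*-identityʳ (b ^ toℕ i)) ⟩
      (k C toℕ i) * b ^ toℕ i
    ∎

[a+b*q]%b≡a : ∀ {a b} q .{{_ : NonZero b}} → a < b → (a + b * q) % b ≡ a
[a+b*q]%b≡a {a} {b} q a<b =
  trans (cong (λ m → (a + m) % b) (*-comm b q)) (trans ([m+kn]%n≡m%n a q b) (m<n⇒m%n≡m a<b))

digit-unique : ∀ {a a' b q q'} → a < b → a' < b → a + b * q ≡ a' + b * q' → a ≡ a' × q ≡ q'
digit-unique {a} {a'} {b@(suc _)} {q} {q'} a<b a'<b eq =
  a≡a' , *-cancelˡ-≡ q q' b (+-cancelˡ-≡ a (b * q) (b * q') (trans eq (cong (_+ b * q') (sym a≡a'))))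
  where
  a≡a' : a ≡ a'
  a≡a' = trans (sym ([a+b*q]%b≡a q a<b)) (trans (cong (_% b) eq) ([a+b*q]%b≡a q' a'<b))

value-injective : ∀ b k (c d : Fin (suc k) → ℕ) → (∀ i → c i < b) → (∀ i → d i < b) →
                  value b k c ≡ value b k d → ∀ i → c i ≡ d i
value-injective b zero c d _ _ eq fz = trans (sym (value-zero b c)) (trans eq (value-zero b d))
value-injective b (suc k) c d c<b d<b eq = λ
  { fz     → proj₁ split
  ; (fs i) → value-injective b k (c ∘ fs) (d ∘ fs) (c<b ∘ fs) (d<b ∘ fs) (proj₂ split) i
  }
  where
  split = digit-unique (c<b fz) (d<b fz) eq

leading*b^k≤value : ∀ b k (c : Fin (suc k) → ℕ) → c (fromℕ k) * b ^ k ≤ value b k c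
leading*b^k≤value b zero    c = ≤-reflexive (trans (*-identityʳ (c fz)) (sym (value-zero b c)))
leading*b^k≤value b (suc k) c = begin
  c (fromℕ (suc k)) * (b * b ^ k)   ≡⟨ x∙yz≈y∙xz (c (fromℕ (suc k))) b (b ^ k) ⟩
  b * (c (fs (fromℕ k)) * b ^ k)    ≤⟨ *-monoʳ-≤ b (leading*b^k≤value b k (c ∘ fs)) ⟩
  b * value b k (c ∘ fs)            ≤⟨ m≤n+m _ (c fz) ⟩
  value b (suc k) c                 ∎
  where open ≤-Reasoning

IsBaseRep⇒b^k≤N : ∀ {b N k c} → IsBaseRep b N k c → b ^ k ≤ N
IsBaseRep⇒b^k≤N {b} {N} {k} {c} (_ , leading>0 , value≡N) = begin
  b ^ k                  ≡⟨ *-identityˡ (b ^ k) ⟨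
  1 * b ^ k              ≤⟨ *-monoˡ-≤ (b ^ k) leading>0 ⟩
  c (fromℕ k) * b ^ k    ≤⟨ leading*b^k≤value b k c ⟩
  value b k c            ≡⟨ value≡N ⟩
  N                      ∎
  where open ≤-Reasoning

2+2^r*kCj≤2^x : ∀ {x k r} → 1 ≤ k → 2 ≤ x → (k + r ≤ x ⊎ (3 ≤ k × k + r ≤ x + 1 × 3 ≤ x)) →
                ∀ j → 2 + 2 ^ r * (k C j) ≤ 2 ^ x
2+2^r*kCj≤2^x {suc x} {suc k} {r} _ (s≤s 1≤x) (inj₁ k+r≤x) j = begin
  2 + 2 ^ r * (suc k C j)    ≤⟨ +-mono-≤ (^-monoʳ-≤ 2 1≤x) (*-monoʳ-≤ (2 ^ r) ([1+n]Ck≤2^n k j)) ⟩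
  2 ^ x + 2 ^ r * 2 ^ k      ≡⟨ cong (2 ^ x +_) (^-distribˡ-+-* 2 r k) ⟨
  2 ^ x + 2 ^ (r + k)        ≤⟨ +-monoʳ-≤ (2 ^ x) (^-monoʳ-≤ 2 (subst (_≤ x) (+-comm k r) (s≤s⁻¹ k+r≤x))) ⟩
  2 ^ x + 2 ^ x              ≡⟨ 2^[1+n]≡2^n+2^n x ⟨
  2 ^ suc x                  ∎
  where open ≤-Reasoning
2+2^r*kCj≤2^x {x} {r = r} _ _ (inj₂ (s≤s (s≤s (s≤s {n = t} z≤n)) , k+r≤x+1 , 3≤x)) =
  large x t (subst (3 + t + r ≤_) (+-comm x 1) k+r≤x+1) 3≤x
  where
  open ≤-Reasoning
  large : ∀ x t → 3 + t + r ≤ suc x → 3 ≤ x → ∀ j → 2 + 2 ^ r * ((3 + t) C j) ≤ 2 ^ x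
  large _ zero 3+r≤3+x (s≤s (s≤s {n = x} 1≤x)) j = begin
    2 + 2 ^ r * (3 C j)  ≤⟨ +-mono-≤ (^-monoʳ-≤ 2 1≤x) (*-mono-≤ (^-monoʳ-≤ 2 r≤x) (3Ck≤3 j)) ⟩
    2 ^ x + 2 ^ x * 3    ≡⟨ p+p*3≡2*[2*p] (2 ^ x) ⟩
    2 ^ (2 + x)          ∎
    where
    r≤x : r ≤ x
    r≤x = s≤s⁻¹ (s≤s⁻¹ (s≤s⁻¹ 3+r≤3+x))
    p+p*3≡2*[2*p] : ∀ p → p + p * 3 ≡ 2 * (2 * p)
    p+p*3≡2*[2*p] = solve-∀
  large x (suc t) k+r≤1+x _ j = begin
    2 + 2 ^ r * ((4 + t) C j)          ≤⟨ +-monoˡ-≤ (2 ^ r * ((4 + t) C j)) (m≤n*m 2 (2 ^ r) {{m^n≢0 2 r}}) ⟩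
    2 ^ r * 2 + 2 ^ r * ((4 + t) C j)  ≡⟨ *-distribˡ-+ (2 ^ r) 2 ((4 + t) C j) ⟨
    2 ^ r * (2 + (4 + t) C j)          ≤⟨ *-monoʳ-≤ (2 ^ r) (2+[4+n]Ck≤2^[3+n] t j) ⟩
    2 ^ r * 2 ^ (3 + t)                ≡⟨ ^-distribˡ-+-* 2 r (3 + t) ⟨
    2 ^ (r + (3 + t))                  ≤⟨ ^-monoʳ-≤ 2 (subst (_≤ x) (+-comm (3 + t) r) (s≤s⁻¹ k+r≤1+x)) ⟩
    2 ^ x                              ∎

binomial-digits-value : ∀ n x k → k * x ≤ n →
                        value (2 ^ x ∸ 1) k (λ i → 2 ^ (n ∸ k * x) * (k C toℕ i)) ≡ 2 ^ n
binomial-digits-value n x k kx≤n = begin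
  value b k (λ i → 2 ^ r * (k C toℕ i))  ≡⟨ value-* b k (2 ^ r) (λ i → k C toℕ i) ⟩
  2 ^ r * value b k (λ i → k C toℕ i)    ≡⟨ cong (2 ^ r *_) (value-binomial b k) ⟩
  2 ^ r * suc b ^ k                      ≡⟨ cong (λ m → 2 ^ r * m ^ k) (suc[2^n∸1]≡2^n x) ⟩
  2 ^ r * (2 ^ x) ^ k                    ≡⟨ cong (2 ^ r *_) (trans (^-*-assoc 2 x k) (cong (2 ^_) (*-comm x k))) ⟩
  2 ^ r * 2 ^ (k * x)                    ≡⟨ ^-distribˡ-+-* 2 r (k * x) ⟨
  2 ^ (r + k * x)                        ≡⟨ cong (2 ^_) (m∸n+n≡m kx≤n) ⟩
  2 ^ n                                  ∎
  where
  open ≡-Reasoning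
  b = 2 ^ x ∸ 1
  r = n ∸ k * x

k*[x∸1]<n : ∀ {n x} k → 1 ≤ n → 2 ≤ x → (2 ^ x ∸ 1) ^ k ≤ 2 ^ n → k * (x ∸ 1) < n
k*[x∸1]<n zero    1≤n _ _ = 1≤n
k*[x∸1]<n {n} {x} k@(suc _) _ 2≤x bᵏ≤2ⁿ = ^-cancelʳ-< 2 (begin-strict
  2 ^ (k * (x ∸ 1))    ≡⟨ cong (2 ^_) (*-comm k (x ∸ 1)) ⟩
  2 ^ ((x ∸ 1) * k)    ≡⟨ ^-*-assoc 2 (x ∸ 1) k ⟨
  (2 ^ (x ∸ 1)) ^ k    <⟨ ^-monoˡ-< k (2^[x∸1]<2^x∸1 2≤x) ⟩
  (2 ^ x ∸ 1) ^ k      ≤⟨ bᵏ≤2ⁿ ⟩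
  2 ^ n                ∎)
  where open ≤-Reasoning

lemma2p3 : (n x k : ℕ) → (c : Fin (suc k) → ℕ) →
    1 ≤ n → 2 ≤ x →
    IsBaseRep (2 ^ x ∸ 1) (2 ^ n) k c →
    IsPalindromic k c →
    (k * (x ∸ 1) < n) ×
    (k * x ≤ n →
      ((k + (n ∸ k * x) ≤ x) ⊎ (3 ≤ k × k + (n ∸ k * x) ≤ x + 1 × 3 ≤ x)) →
      (i : Fin (suc k)) → c i ≡ 2 ^ (n ∸ k * x) * (k C toℕ i))
lemma2p3 n x zero c 1≤n _ (_ , _ , value≡2ⁿ) _ =
  1≤n , λ { _ _ fz → trans (sym (value-zero (2 ^ x ∸ 1) c)) (trans value≡2ⁿ (sym (*-identityʳ (2 ^ n)))) }
lemma2p3 n x k@(suc _) c 1≤n 2≤x rep@(c<b , _ , value≡2ⁿ) _ =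
  k*[x∸1]<n k 1≤n 2≤x (IsBaseRep⇒b^k≤N rep) ,
  λ kx≤n small → value-injective (2 ^ x ∸ 1) k c binomial c<b
    (λ i → 2+m≤n⇒m<n∸1 (2+2^r*kCj≤2^x (s≤s z≤n) 2≤x small (toℕ i)))
    (trans value≡2ⁿ (sym (binomial-digits-value n x k kx≤n)))
  where
  binomial : Fin (suc k) → ℕ
  binomial i = 2 ^ (n ∸ k * x) * (k C toℕ i)
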